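{- Let $\mathbf{A}\in\mathbb{Z}^{r\times n}$ with $r\le 0.25n$ be a full-rank integer matrix whose entries are bounded in absolute value by $M$, for some $M\ge n$. Then there exists a matrix $\mathbf{A}'\in\mathbb{Z}^{m\times n}$ with $m\le 4r$, obtained by adding integer rows to $\mathbf{A}$ (so every row of $\mathbf{A}$ is a row of $\mathbf{A}'$), such that $\lambda_{\max}(\mathcal{L}^\perp(\mathbf{A}'))\le\ell_{\mathbf{A}}$, where $\ell_{\mathbf{A}}=\sqrt{nM^2}$.
   Context: For a matrix $\mathbf{A}'$, the orthogonal lattice $\mathcal{L}^\perp(\mathbf{A}')$ is the lattice of all $\mathbf{y}\in\mathbb{Z}^n$ orthogonal to every row of $\mathbf{A}'$. For a lattice $\mathcal{L}$, the $i$-th successive minimum $\lambda_i(\mathcal{L})$ is the smallest radius $\rho$ such that the ball of radius $\rho$ centered at the origin contains $i$ linearly independent lattice vectors; $\lambda_{\max}(\mathcal{L})$ is the last successive minimum (index equal to the rank of $\mathcal{L}$). -}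

module Defs where

open import Data.Nat using (ℕ; zero; suc)
open import Data.Integer using (ℤ; _+_; _*_; _≤_; +_; 0ℤ)
open import Data.Fin using (Fin)
import Data.Vec.Functional as VF
open import Data.Product using (Σ; _×_; ∃)
open import Relation.Binary.PropositionalEquality using (_≡_)
open import Relation.Nullary using (¬_)

ZVec : ℕ → Set
ZVec n = Fin n → ℤ

ZMat : ℕ → ℕ → Set
ZMat r n = Fin r → ZVec n

∑ : ∀ {k} → (Fin k → ℤ) → ℤ
∑ f = VF.foldr _+_ 0ℤ f

dot : ∀ {n} → ZVec n → ZVec n → ℤ
dot u v = ∑ (λ j → u j * v j)

sqNorm : ∀ {n} → ZVec n → ℤ
sqNorm v = dot v v

Lattice : ℕ → Set₁
Lattice n = ZVec n → Set

orthLattice : ∀ {m n} → ZMat m n → Lattice n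
orthLattice A' y = ∀ i → dot (A' i) y ≡ 0ℤ

-- linear independence of a family of k integer vectors (over ℤ, equivalently over ℚ)
LinIndep : ∀ {k n} → (Fin k → ZVec n) → Set
LinIndep {k} {n} v =
  (c : Fin k → ℤ) → (∀ j → ∑ (λ i → c i * v i j) ≡ 0ℤ) → ∀ i → c i ≡ 0ℤ

AllIn : ∀ {k n} → Lattice n → (Fin k → ZVec n) → Set
AllIn L v = ∀ i → L (v i)

LatticeRank : ∀ {n} → Lattice n → ℕ → Set
LatticeRank {n} L d =
  Σ (Fin d → ZVec n) (λ v → AllIn L v × LinIndep v)
  × ((v : Fin (suc d) → ZVec n) → AllIn L v → ¬ LinIndep v)

-- λ_max(L) ≤ √B, i.e. the closed ball of radius √B contains rank(L) many
-- linearly independent lattice vectors (squared norms compared, B = ρ²)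
LambdaMaxSq≤ : ∀ {n} → Lattice n → ℤ → Set
LambdaMaxSq≤ {n} L B =
  ∃ λ d → LatticeRank L d ×
    Σ (Fin d → ZVec n) (λ v → AllIn L v × LinIndep v × (∀ i → sqNorm (v i) ≤ B))

{-# OPTIONS --safe #-}
-- Put d = n - 4r.  Siegel's lemma (pigeonhole on the box [0, M]^n) yields, one after the other,
-- d vectors of L^⊥(A) with entries in [-M, M], each vanishing at the pivot coordinates of the
-- previous ones: a row a of A costs a factor 1 + ∥a∥₁ M ≤ 1 + n M² ≤ (M + 1)³ in the count (this
-- is where n ≤ M enters) and each pivot condition a factor M + 1, so 3r + d ≤ n suffices.  Such
-- an echelon family is linearly independent and its squared norms are at most n M².  As every
-- underdetermined integer system has a nonzero solution, there are 3r further echelon rows B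
-- orthogonal to A and to the d short vectors.  Then A ++ B has 4r independent rows, so
-- L^⊥(A ++ B) has rank exactly n - 4r = d, and it contains the d short vectors.
module Submission where

open import Defs
open import Algebra.Bundles using (Monoid)
open import Data.Fin as Fin using (Fin; zero; suc; _↑ˡ_; _↑ʳ_; splitAt)
open import Data.Fin.Properties using (splitAt⁻¹-↑ˡ; splitAt⁻¹-↑ʳ)
open import Data.Product using (Σ; _×_; _,_; ∃; ∃₂; proj₁; proj₂)
open import Data.Sum using (inj₁; inj₂)
open import Data.Vec.Functional using (_++_; _∷_)
open import Data.Vec.Functional.Properties using (lookup-++ˡ; lookup-++ʳ)
open import Function using (_∘_)
open import Relation.Nullary using (¬_; contradiction)
open import Relation.Binary.PropositionalEquality
  using (_≡_; _≢_; refl; sym; trans; cong; cong₂; subst; module ≡-Reasoning)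
import Data.Nat as ℕ
import Data.Nat.Properties as ℕ
import Algebra.Properties.Semiring.Sum ℕ.+-*-semiring as ℕΣ

module _ {c ℓ} (M : Monoid c ℓ) where
  open Monoid M using (Carrier; _≈_; _∙_; ∙-congˡ; assoc; identityˡ)
    renaming (sym to ≈-sym; trans to ≈-trans)
  open import Algebra.Properties.Monoid.Sum M using (sum)

  sum-splitAt : ∀ p {q} (f : Fin (p ℕ.+ q) → Carrier) →
                sum f ≈ sum (f ∘ (_↑ˡ q)) ∙ sum (f ∘ (p ↑ʳ_))
  sum-splitAt ℕ.zero    f = ≈-sym (identityˡ _)
  sum-splitAt (ℕ.suc p) f = ≈-trans (∙-congˡ (sum-splitAt p (f ∘ suc))) (≈-sym (assoc _ _ _))

∑ℕ : ∀ {k} → (Fin k → ℕ.ℕ) → ℕ.ℕ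
∑ℕ = ℕΣ.sum

module IntegerVectors where

  open import Data.Integer using (ℤ; +_; -[1+_]; 0ℤ; 1ℤ; _+_; _*_; -_; ∣_∣; _⊖_)
  open import Data.Integer.Properties
  open import Algebra.Properties.Semiring.Sum +-*-semiring
    using (sum-cong-≗; sum-replicate-zero; ∑-comm; ∑-distrib-+; *-distribˡ-sum; *-distribʳ-sum)
  open import Algebra.Properties.AbelianGroup +-0-abelianGroup using (identityˡ-unique; ∙-cancelʳ)
  open import Data.Integer.Tactic.RingSolver using (solve-∀)
  open ≡-Reasoning

  ∑-zero : ∀ {k} {f : Fin k → ℤ} → (∀ i → f i ≡ 0ℤ) → ∑ f ≡ 0ℤ
  ∑-zero {k} f≡0 = trans (sum-cong-≗ f≡0) (sum-replicate-zero k)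

  pos-∑ : ∀ {k} (f : Fin k → ℕ.ℕ) → + ∑ℕ f ≡ ∑ (λ i → + f i)
  pos-∑ {ℕ.zero}  f = refl
  pos-∑ {ℕ.suc k} f = trans (pos-+ (f zero) _) (cong (_+_ (+ f zero)) (pos-∑ (f ∘ suc)))

  ∑ℕ≡0⇒≡0 : ∀ {k} (f : Fin k → ℕ.ℕ) → ∑ℕ f ≡ 0 → ∀ i → f i ≡ 0
  ∑ℕ≡0⇒≡0 f ∑≡0 zero    = ℕ.m+n≡0⇒m≡0 (f zero) ∑≡0
  ∑ℕ≡0⇒≡0 f ∑≡0 (suc i) = ∑ℕ≡0⇒≡0 (f ∘ suc) (ℕ.m+n≡0⇒n≡0 (f zero) ∑≡0) i

  ∥_∥₁ : ∀ {n} → ZVec n → ℕ.ℕ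
  ∥ v ∥₁ = ∑ℕ (λ j → ∣ v j ∣)

  NonZeroVec : ∀ {n} → ZVec n → Set
  NonZeroVec y = ∃ λ j → y j ≢ 0ℤ

  linComb : ∀ {k n} → (Fin k → ℤ) → (Fin k → ZVec n) → ZVec n
  linComb c v j = ∑ (λ i → c i * v i j)

  dot-comm : ∀ {n} (u v : ZVec n) → dot u v ≡ dot v u
  dot-comm u v = sum-cong-≗ (λ j → *-comm (u j) (v j))

  dot-distribˡ-+ : ∀ {n} (x u w : ZVec n) → dot x (λ j → u j + w j) ≡ dot x u + dot x w
  dot-distribˡ-+ x u w = trans (sum-cong-≗ (λ j → *-distribˡ-+ (x j) (u j) (w j)))
                               (∑-distrib-+ (λ j → x j * u j) (λ j → x j * w j))

  dot-linComb : ∀ {k n} (c : Fin k → ℤ) (v : Fin k → ZVec n) (x : ZVec n) →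
                dot (linComb c v) x ≡ ∑ (λ i → c i * dot (v i) x)
  dot-linComb c v x = begin
    ∑ (λ j → ∑ (λ i → c i * v i j) * x j)
      ≡⟨ sum-cong-≗ (λ j → *-distribʳ-sum (x j) (λ i → c i * v i j)) ⟩
    ∑ (λ j → ∑ (λ i → c i * v i j * x j))
      ≡⟨ ∑-comm (λ j i → c i * v i j * x j) ⟩
    ∑ (λ i → ∑ (λ j → c i * v i j * x j))
      ≡⟨ sum-cong-≗ (λ i → sum-cong-≗ (λ j → *-assoc (c i) (v i j) (x j))) ⟩
    ∑ (λ i → ∑ (λ j → c i * (v i j * x j)))
      ≡⟨ sum-cong-≗ (λ i → *-distribˡ-sum (c i) (λ j → v i j * x j)) ⟨
    ∑ (λ i → c i * dot (v i) x)
      ∎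

  linComb-orthogonal : ∀ {k n} (c : Fin k → ℤ) (v : Fin k → ZVec n) {x : ZVec n} →
                       (∀ i → dot (v i) x ≡ 0ℤ) → dot (linComb c v) x ≡ 0ℤ
  linComb-orthogonal c v v⊥x =
    trans (dot-linComb c v _) (∑-zero (λ i → trans (cong (c i *_) (v⊥x i)) (*-zeroʳ (c i))))

  i*i≡∣i∣*∣i∣ : ∀ i → i * i ≡ + (∣ i ∣ ℕ.* ∣ i ∣)
  i*i≡∣i∣*∣i∣ (+ n)    = sym (pos-* n n)
  i*i≡∣i∣*∣i∣ -[1+ n ] = refl

  sqNorm≡∑ℕ : ∀ {n} (v : ZVec n) → sqNorm v ≡ + ∑ℕ (λ j → ∣ v j ∣ ℕ.* ∣ v j ∣)
  sqNorm≡∑ℕ v = trans (sum-cong-≗ (λ j → i*i≡∣i∣*∣i∣ (v j)))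
                      (sym (pos-∑ (λ j → ∣ v j ∣ ℕ.* ∣ v j ∣)))

  sqNorm≡0⇒≡0 : ∀ {n} (v : ZVec n) → sqNorm v ≡ 0ℤ → ∀ j → v j ≡ 0ℤ
  sqNorm≡0⇒≡0 v ∥v∥²≡0 j with ℕ.m*n≡0⇒m≡0∨n≡0 ∣ v j ∣ (∑ℕ≡0⇒≡0 _ ∑ℕ≡0 j)
    where ∑ℕ≡0 = +-injective (trans (sym (sqNorm≡∑ℕ v)) ∥v∥²≡0)
  ... | inj₁ ∣vj∣≡0 = ∣i∣≡0⇒i≡0 ∣vj∣≡0
  ... | inj₂ ∣vj∣≡0 = ∣i∣≡0⇒i≡0 ∣vj∣≡0

  unitVec : ∀ {n} → Fin n → ZVec n
  unitVec zero    zero    = 1ℤ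
  unitVec zero    (suc _) = 0ℤ
  unitVec (suc p) zero    = 0ℤ
  unitVec (suc p) (suc j) = unitVec p j

  dot-unitVec : ∀ {n} (p : Fin n) (y : ZVec n) → dot (unitVec p) y ≡ y p
  dot-unitVec zero    y =
    trans (cong₂ _+_ (*-identityˡ (y zero)) (∑-zero (λ j → *-zeroˡ (y (suc j)))))
          (+-identityʳ (y zero))
  dot-unitVec (suc p) y = trans (+-identityˡ _) (dot-unitVec p (y ∘ suc))

  ∥unitVec∥₁ : ∀ {n} (p : Fin n) → ∥ unitVec p ∥₁ ≡ 1
  ∥unitVec∥₁ {ℕ.suc n} zero    = cong ℕ.suc (ℕΣ.sum-replicate-zero n)
  ∥unitVec∥₁           (suc p) = ∥unitVec∥₁ p

  orthLattice-unitVecs : ∀ {s n} (piv : Fin s → Fin n) {y : ZVec n} →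
                         orthLattice (unitVec ∘ piv) y → ∀ k → y (piv k) ≡ 0ℤ
  orthLattice-unitVecs piv {y} y⊥ k = trans (sym (dot-unitVec (piv k) y)) (y⊥ k)

  orthLattice-++ : ∀ {p q n} (X : ZMat p n) (Z : ZMat q n) {y : ZVec n} →
                   orthLattice X y → orthLattice Z y → orthLattice (X ++ Z) y
  orthLattice-++ {p} X Z y⊥X y⊥Z i with splitAt p i
  ... | inj₁ a = y⊥X a
  ... | inj₂ b = y⊥Z b

  orthLattice-++⁻ˡ : ∀ {p q n} (X : ZMat p n) (Z : ZMat q n) {y : ZVec n} →
                     orthLattice (X ++ Z) y → orthLattice X y
  orthLattice-++⁻ˡ X Z {y} y⊥ i = subst (λ x → dot x y ≡ 0ℤ) (lookup-++ˡ X Z i) (y⊥ (i ↑ˡ _))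

  orthLattice-++⁻ʳ : ∀ {p q n} (X : ZMat p n) (Z : ZMat q n) {y : ZVec n} →
                     orthLattice (X ++ Z) y → orthLattice Z y
  orthLattice-++⁻ʳ {p} X Z {y} y⊥ i = subst (λ x → dot x y ≡ 0ℤ) (lookup-++ʳ X Z i) (y⊥ (p ↑ʳ i))

  orthLattice-sym : ∀ {p q n} (X : ZMat p n) (Z : ZMat q n) →
                    (∀ k → orthLattice X (Z k)) → ∀ i → orthLattice Z (X i)
  orthLattice-sym X Z Z⊥X i k = trans (dot-comm (Z k) (X i)) (Z⊥X k i)

  linIndep-++ : ∀ {p q n} (X : ZMat p n) (Z : ZMat q n) → LinIndep X → LinIndep Z →
                (∀ k → orthLattice X (Z k)) → LinIndep (X ++ Z)
  linIndep-++ {p} {q} X Z indX indZ Z⊥X c rel = c≡0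
    where
    α = c ∘ (_↑ˡ q)
    β = c ∘ (p ↑ʳ_)
    u = linComb α X
    w = linComb β Z

    u+w≡0 : ∀ j → u j + w j ≡ 0ℤ
    u+w≡0 j = begin
      u j + w j
        ≡⟨ cong₂ _+_ (sum-cong-≗ (λ i → cong (λ x → α i * x j) (lookup-++ˡ X Z i)))
                     (sum-cong-≗ (λ k → cong (λ x → β k * x j) (lookup-++ʳ X Z k))) ⟨
      ∑ (λ i → c (i ↑ˡ q) * (X ++ Z) (i ↑ˡ q) j) + ∑ (λ k → c (p ↑ʳ k) * (X ++ Z) (p ↑ʳ k) j)
        ≡⟨ sum-splitAt +-0-monoid p (λ i → c i * (X ++ Z) i j) ⟨
      linComb c (X ++ Z) j
        ≡⟨ rel j ⟩
      0ℤ ∎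

    -- w is orthogonal to every row of X, hence to u, and as u + w = 0 also to itself.
    w⊥X : orthLattice X w
    w⊥X i = trans (dot-comm (X i) w) (linComb-orthogonal β Z (orthLattice-sym X Z Z⊥X i))

    w≡0 : ∀ j → w j ≡ 0ℤ
    w≡0 = sqNorm≡0⇒≡0 w (begin
      dot w w                          ≡⟨ +-identityˡ (dot w w) ⟨
      0ℤ + dot w w                     ≡⟨ cong (_+ dot w w) w⊥u ⟨
      dot w u + dot w w                ≡⟨ dot-distribˡ-+ w u w ⟨
      dot w (λ j → u j + w j)
        ≡⟨ ∑-zero (λ j → trans (cong (w j *_) (u+w≡0 j)) (*-zeroʳ (w j))) ⟩
      0ℤ                               ∎)
      where
      w⊥u : dot w u ≡ 0ℤ
      w⊥u = trans (dot-comm w u) (linComb-orthogonal α X w⊥X)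

    u≡0 : ∀ j → u j ≡ 0ℤ
    u≡0 j = trans (sym (+-identityʳ (u j))) (trans (cong (_+_ (u j)) (sym (w≡0 j))) (u+w≡0 j))

    c≡0 : ∀ i → c i ≡ 0ℤ
    c≡0 i with splitAt p i in eq
    ... | inj₁ a = subst (λ i → c i ≡ 0ℤ) (splitAt⁻¹-↑ˡ eq) (indX α u≡0 a)
    ... | inj₂ b = subst (λ i → c i ≡ 0ℤ) (splitAt⁻¹-↑ʳ eq) (indZ β w≡0 b)

  Echelon : ∀ {s n} → (Fin s → ZVec n) → (Fin s → Fin n) → Set
  Echelon Y piv = (∀ i → Y i (piv i) ≢ 0ℤ) × (∀ i k → i Fin.< k → Y i (piv k) ≡ 0ℤ)

  echelon-pivots : ∀ {s n} {Y : Fin s → ZVec n} {piv : Fin s → Fin n} → Echelon Y piv →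
                   (c : Fin s → ℤ) → (∀ k → linComb c Y (piv k) ≡ 0ℤ) → ∀ i → c i ≡ 0ℤ
  echelon-pivots {ℕ.suc s} {Y = Y} {piv} (pivot≢0 , above≡0) c rel = c≡0
    where
    tail≡0 : ∀ i → c (suc i) ≡ 0ℤ
    tail≡0 = echelon-pivots {Y = Y ∘ suc} {piv ∘ suc}
               (pivot≢0 ∘ suc , λ i k i<k → above≡0 (suc i) (suc k) (ℕ.s<s i<k)) (c ∘ suc) tail-rel
      where
      tail-rel : ∀ k → linComb (c ∘ suc) (Y ∘ suc) (piv (suc k)) ≡ 0ℤ
      tail-rel k = begin
        rest                          ≡⟨ +-identityˡ rest ⟨
        0ℤ + rest                     ≡⟨ cong (_+ rest) (*-zeroʳ (c zero)) ⟨
        c zero * 0ℤ + rest            ≡⟨ cong (λ y → c zero * y + rest) (above≡0 zero (suc k) ℕ.z<s) ⟨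
        linComb c Y (piv (suc k))     ≡⟨ rel (suc k) ⟩
        0ℤ                            ∎
        where rest = linComb (c ∘ suc) (Y ∘ suc) (piv (suc k))
    c₀Y₀≡0 : c zero * Y zero (piv zero) ≡ 0ℤ
    c₀Y₀≡0 = begin
      c₀Y₀                      ≡⟨ +-identityʳ c₀Y₀ ⟨
      c₀Y₀ + 0ℤ                 ≡⟨ cong (_+_ c₀Y₀) (∑-zero tail-terms≡0) ⟨
      linComb c Y (piv zero)    ≡⟨ rel zero ⟩
      0ℤ                        ∎
      where
      c₀Y₀ = c zero * Y zero (piv zero)
      tail-terms≡0 : ∀ i → c (suc i) * Y (suc i) (piv zero) ≡ 0ℤ
      tail-terms≡0 i = trans (cong (_* Y (suc i) (piv zero)) (tail≡0 i)) (*-zeroˡ (Y (suc i) (piv zero)))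
    c≡0 : ∀ i → c i ≡ 0ℤ
    c≡0 zero with i*j≡0⇒i≡0∨j≡0 (c zero) c₀Y₀≡0
    ... | inj₁ c₀≡0 = c₀≡0
    ... | inj₂ Y₀≡0 = contradiction Y₀≡0 (pivot≢0 zero)
    c≡0 (suc i) = tail≡0 i

  echelon⇒linIndep : ∀ {s n} {Y : Fin s → ZVec n} {piv : Fin s → Fin n} → Echelon Y piv → LinIndep Y
  echelon⇒linIndep {Y = Y} {piv} ech c rel = echelon-pivots {Y = Y} ech c (rel ∘ piv)

  echelon-∷ : ∀ {s n} {Y : Fin s → ZVec n} {piv : Fin s → Fin n} {y : ZVec n} {j : Fin n} →
              Echelon Y piv → (∀ k → y (piv k) ≡ 0ℤ) → y j ≢ 0ℤ → Echelon (y ∷ Y) (j ∷ piv)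
  echelon-∷ {Y = Y} {piv} {y} {j} (pivot≢0 , above≡0) y↾piv≡0 yj≢0 = pivot≢0′ , above≡0′
    where
    pivot≢0′ : ∀ i → (y ∷ Y) i ((j ∷ piv) i) ≢ 0ℤ
    pivot≢0′ zero    = yj≢0
    pivot≢0′ (suc i) = pivot≢0 i
    above≡0′ : ∀ i k → i Fin.< k → (y ∷ Y) i ((j ∷ piv) k) ≡ 0ℤ
    above≡0′ zero    (suc k) _           = y↾piv≡0 k
    above≡0′ (suc i) (suc k) (ℕ.s<s i<k) = above≡0 i k i<k

  echelon-build : ∀ {n} (P : Lattice n) d →
    (∀ {s} → s ℕ.< d → (piv : Fin s → Fin n) →
       ∃ λ y → P y × (∀ k → y (piv k) ≡ 0ℤ) × NonZeroVec y) →
    ∃₂ λ (Y : Fin d → ZVec n) piv → AllIn P Y × Echelon Y piv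
  echelon-build {n} P d extend = build d ℕ.≤-refl
    where
    build : ∀ s → s ℕ.≤ d → ∃₂ λ (Y : Fin s → ZVec n) piv → AllIn P Y × Echelon Y piv
    build ℕ.zero    _   = (λ ()) , (λ ()) , (λ ()) , (λ ()) , (λ ())
    build (ℕ.suc s) s<d with build s (ℕ.<⇒≤ s<d)
    ... | Y , piv , Y∈P , ech with extend s<d piv
    ...   | y , y∈P , y↾piv≡0 , j , yj≢0 =
      y ∷ Y , j ∷ piv , (λ { zero → y∈P ; (suc i) → Y∈P i }) , echelon-∷ ech y↾piv≡0 yj≢0

  -- For 0 ≤ y ≤ M the product c * y lies in [-∣c∣ M, ∣c∣ M]; for negative c it is shifted by
  -- the offset ∣c∣ M into [0, ∣c∣ M], so that it can be used as a digit in Siegel's lemma.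
  shift : ℕ.ℕ → ℤ → ℕ.ℕ → ℕ.ℕ
  shift M (+ a)    y = a ℕ.* y
  shift M -[1+ a ] y = ℕ.suc a ℕ.* (M ℕ.∸ y)

  offset : ℕ.ℕ → ℤ → ℕ.ℕ
  offset M (+ a)    = 0
  offset M -[1+ a ] = ℕ.suc a ℕ.* M

  shift-≤ : ∀ M c {y} → y ℕ.≤ M → shift M c y ℕ.≤ ∣ c ∣ ℕ.* M
  shift-≤ M (+ a)    y≤M = ℕ.*-monoʳ-≤ a y≤M
  shift-≤ M -[1+ a ] {y} _ = ℕ.*-monoʳ-≤ (ℕ.suc a) (ℕ.m∸n≤m M y)

  shift-≡ : ∀ M c {y} → y ℕ.≤ M → + shift M c y ≡ c * + y + + offset M c
  shift-≡ M (+ a)    {y} _   = trans (pos-* a y) (sym (+-identityʳ _))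
  shift-≡ M -[1+ a ] {y} y≤M = begin
    + (ℕ.suc a ℕ.* k)
      ≡⟨ pos-* (ℕ.suc a) k ⟩
    + ℕ.suc a * + k
      ≡⟨ balance (+ ℕ.suc a) (+ y) (+ k) ⟩
    -[1+ a ] * + y + + ℕ.suc a * (+ y + + k)
      ≡⟨ cong (λ z → -[1+ a ] * + y + + ℕ.suc a * z) (pos-+ y k) ⟨
    -[1+ a ] * + y + + ℕ.suc a * + (y ℕ.+ k)
      ≡⟨ cong (_+_ (-[1+ a ] * + y)) (pos-* (ℕ.suc a) (y ℕ.+ k)) ⟨
    -[1+ a ] * + y + + (ℕ.suc a ℕ.* (y ℕ.+ k))
      ≡⟨ cong (λ z → -[1+ a ] * + y + + (ℕ.suc a ℕ.* z)) (ℕ.m+[n∸m]≡n y≤M) ⟩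
    -[1+ a ] * + y + + (ℕ.suc a ℕ.* M)
      ∎
    where
    k = M ℕ.∸ y
    balance : ∀ a y k → a * k ≡ - a * y + a * (y + k)
    balance = solve-∀

  code : ℕ.ℕ → ∀ {n} → ZVec n → (Fin n → ℕ.ℕ) → ℕ.ℕ
  code M c y = ∑ℕ (λ j → shift M (c j) (y j))

  code-≡ : ∀ M {n} (c : ZVec n) {y : Fin n → ℕ.ℕ} → (∀ j → y j ℕ.≤ M) →
           + code M c y ≡ dot c (+_ ∘ y) + + ∑ℕ (λ j → offset M (c j))
  code-≡ M c {y} y≤M = begin
    + code M c y
      ≡⟨ pos-∑ (λ j → shift M (c j) (y j)) ⟩
    ∑ (λ j → + shift M (c j) (y j))
      ≡⟨ sum-cong-≗ (λ j → shift-≡ M (c j) (y≤M j)) ⟩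
    ∑ (λ j → c j * + y j + + offset M (c j))
      ≡⟨ ∑-distrib-+ (λ j → c j * + y j) (λ j → + offset M (c j)) ⟩
    dot c (+_ ∘ y) + ∑ (λ j → + offset M (c j))
      ≡⟨ cong (_+_ (dot c (+_ ∘ y))) (pos-∑ (λ j → offset M (c j))) ⟨
    dot c (+_ ∘ y) + + ∑ℕ (λ j → offset M (c j))
      ∎

  ⊖-+-cancel : ∀ m n → m ⊖ n + + n ≡ + m
  ⊖-+-cancel m n =
    trans (distribˡ-⊖-+-pos n m n) (trans (⊖-≥ (ℕ.m≤n+m n m)) (cong +_ (ℕ.m+n∸n≡m m n)))

  code-≡⇒dot-⊖≡0 : ∀ M {n} (c : ZVec n) {a b : Fin n → ℕ.ℕ} →
                   (∀ j → a j ℕ.≤ M) → (∀ j → b j ℕ.≤ M) →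
                   code M c a ≡ code M c b → dot c (λ j → a j ⊖ b j) ≡ 0ℤ
  code-≡⇒dot-⊖≡0 M c {a} {b} a≤M b≤M codes≡ = identityˡ-unique _ _ (begin
    dot c (λ j → a j ⊖ b j) + dot c (+_ ∘ b)        ≡⟨ dot-distribˡ-+ c (λ j → a j ⊖ b j) (+_ ∘ b) ⟨
    dot c (λ j → a j ⊖ b j + + b j)
      ≡⟨ sum-cong-≗ (λ j → cong (c j *_) (⊖-+-cancel (a j) (b j))) ⟩
    dot c (+_ ∘ a)                                  ≡⟨ dots≡ ⟩
    dot c (+_ ∘ b)                                  ∎)
    where
    K = + ∑ℕ (λ j → offset M (c j))
    dots≡ : dot c (+_ ∘ a) ≡ dot c (+_ ∘ b)
    dots≡ = ∙-cancelʳ K _ _ (trans (sym (code-≡ M c a≤M)) (trans (cong +_ codes≡) (code-≡ M c b≤M)))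

  m⊖n≡0⇒m≡n : ∀ m n → m ⊖ n ≡ 0ℤ → m ≡ n
  m⊖n≡0⇒m≡n m n m⊖n≡0 = +-injective (i-j≡0⇒i≡j (+ m) (+ n) (trans ([+m]-[+n]≡m⊖n m n) m⊖n≡0))

  ∣m⊖n∣≤ : ∀ {m n M} → m ℕ.≤ M → n ℕ.≤ M → ∣ m ⊖ n ∣ ℕ.≤ M
  ∣m⊖n∣≤ {m} {n} m≤M n≤M = ℕ.≤-trans (∣m⊝n∣≤m⊔n m n) (ℕ.⊔-lub m≤M n≤M)

open IntegerVectors

open import Data.Nat using (ℕ; zero; suc; _+_; _*_; _^_; _∸_; _≤_; _<_; z≤n; s≤s)
open import Data.Nat.Properties
open import Data.Integer using (∣_∣; +_; _⊖_; 0ℤ)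
import Data.Integer as Z
open import Data.Fin using (toℕ; fromℕ<; combine; finToFun; funToFin)
open import Data.Fin.Properties
  using (toℕ<n; toℕ-fromℕ<; toℕ-injective; combine-injective; funToFin-finToFin; pigeonhole; ¬∀⟶∃¬)
  renaming (_≟_ to _≟ᶠ_; <⇒≢ to <⇒≢ᶠ)
open import Data.Nat.Tactic.RingSolver using (solve-∀)
open import Algebra.Properties.CommutativeMonoid.Sum *-1-commutativeMonoid
  using () renaming (sum to ∏; ∑-distrib-+ to ∏-distrib-*)

∑ℕ-mono-≤ : ∀ {k} {f g : Fin k → ℕ} → (∀ i → f i ≤ g i) → ∑ℕ f ≤ ∑ℕ g
∑ℕ-mono-≤ {zero}  f≤g = ≤-refl
∑ℕ-mono-≤ {suc k} f≤g = +-mono-≤ (f≤g zero) (∑ℕ-mono-≤ (f≤g ∘ suc))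

∑ℕ-≤-* : ∀ {k} {f : Fin k → ℕ} {b} → (∀ i → f i ≤ b) → ∑ℕ f ≤ k * b
∑ℕ-≤-* {zero}  f≤b = ≤-refl
∑ℕ-≤-* {suc k} f≤b = +-mono-≤ (f≤b zero) (∑ℕ-≤-* (f≤b ∘ suc))

∏-mono-≤ : ∀ {k} {f g : Fin k → ℕ} → (∀ i → f i ≤ g i) → ∏ f ≤ ∏ g
∏-mono-≤ {zero}  f≤g = ≤-refl
∏-mono-≤ {suc k} f≤g = *-mono-≤ (f≤g zero) (∏-mono-≤ (f≤g ∘ suc))

∏-const : ∀ k {b} → ∏ {k} (λ _ → b) ≡ b ^ k
∏-const zero    = refl
∏-const (suc k) {b} = cong (b *_) (∏-const k)

∏-splitAt : ∀ p {q} (f : Fin (p + q) → ℕ) → ∏ f ≡ ∏ (f ∘ (_↑ˡ q)) * ∏ (f ∘ (p ↑ʳ_))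
∏-splitAt = sum-splitAt *-1-monoid

∏-≤-^ : ∀ {k} {f : Fin k → ℕ} {b} → (∀ i → f i ≤ b) → ∏ f ≤ b ^ k
∏-≤-^ {k} f≤b = ≤-trans (∏-mono-≤ f≤b) (≤-reflexive (∏-const k))

encode : ∀ {k} (R : Fin k → ℕ) → ((i : Fin k) → Fin (R i)) → Fin (∏ R)
encode {zero}  R g = zero
encode {suc k} R g = combine (g zero) (encode (R ∘ suc) (g ∘ suc))

encode-injective : ∀ {k} (R : Fin k → ℕ) (g h : (i : Fin k) → Fin (R i)) →
                   encode R g ≡ encode R h → ∀ i → g i ≡ h i
encode-injective {suc k} R g h eq i with combine-injective (g zero) _ (h zero) _ eq
encode-injective {suc k} R g h eq zero    | g₀≡h₀ , _ = g₀≡h₀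
encode-injective {suc k} R g h eq (suc i) | _ , rest≡ =
  encode-injective (R ∘ suc) (g ∘ suc) (h ∘ suc) rest≡ i

funToFin-cong : ∀ {k m} {f g : Fin k → Fin m} → (∀ i → f i ≡ g i) → funToFin f ≡ funToFin g
funToFin-cong {zero}  f≗g = refl
funToFin-cong {suc k} f≗g = cong₂ combine (f≗g zero) (funToFin-cong (f≗g ∘ suc))

finToFun-injective : ∀ {k m} (x y : Fin (m ^ k)) →
                     (∀ i → finToFun {m} {k} x i ≡ finToFun y i) → x ≡ y
finToFun-injective {k} {m} x y x≗y = begin
  x                           ≡⟨ funToFin-finToFin {k} {m} x ⟨
  funToFin {k} (finToFun x)   ≡⟨ funToFin-cong x≗y ⟩
  funToFin {k} (finToFun y)   ≡⟨ funToFin-finToFin {k} {m} y ⟩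
  y                           ∎
  where open ≡-Reasoning

code-≤ : ∀ M {n} (c : ZVec n) {y : Fin n → ℕ} → (∀ j → y j ≤ M) → code M c y ≤ ∥ c ∥₁ * M
code-≤ M c y≤M = begin
  ∑ℕ (λ j → shift M (c j) _)     ≤⟨ ∑ℕ-mono-≤ (λ j → shift-≤ M (c j) (y≤M j)) ⟩
  ∑ℕ (λ j → ∣ c j ∣ * M)         ≡⟨ ℕΣ.*-distribʳ-sum M (λ j → ∣ c j ∣) ⟨
  ∥ c ∥₁ * M                     ∎
  where open ≤-Reasoning

-- Pigeonhole: two of the (M + 1)^n points of [0, M]^n have the same codes for all rows of C,
-- and their difference is the solution.
siegel : ∀ {m n} M (C : ZMat m n) → ∏ (λ i → suc (∥ C i ∥₁ * M)) < suc M ^ n →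
         ∃ λ y → orthLattice C y × NonZeroVec y × (∀ j → ∣ y j ∣ ≤ M)
siegel {m} {n} M C fewer-codes = y , C⊥y , y≢0 , y≤M
  where
  point : Fin (suc M ^ n) → Fin n → ℕ
  point x j = toℕ (finToFun x j)

  point≤M : ∀ x j → point x j ≤ M
  point≤M x j = ≤-pred (toℕ<n (finToFun x j))

  codes : Fin (suc M ^ n) → (i : Fin m) → Fin (suc (∥ C i ∥₁ * M))
  codes x i = fromℕ< (s≤s (code-≤ M (C i) (point≤M x)))

  collision = pigeonhole fewer-codes (encode _ ∘ codes)
  x  = proj₁ collision
  x′ = proj₁ (proj₂ collision)
  x<x′      = proj₁ (proj₂ (proj₂ collision))
  encoding≡ = proj₂ (proj₂ (proj₂ collision))

  y : ZVec n
  y j = point x j ⊖ point x′ j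

  same-code : ∀ i → code M (C i) (point x) ≡ code M (C i) (point x′)
  same-code i = begin
    code M (C i) (point x)          ≡⟨ toℕ-fromℕ< _ ⟨
    toℕ (codes x i)
      ≡⟨ cong toℕ (encode-injective _ (codes x) (codes x′) encoding≡ i) ⟩
    toℕ (codes x′ i)                ≡⟨ toℕ-fromℕ< _ ⟩
    code M (C i) (point x′)         ∎
    where open ≡-Reasoning

  C⊥y : orthLattice C y
  C⊥y i = code-≡⇒dot-⊖≡0 M (C i) (point≤M x) (point≤M x′) (same-code i)

  y≢0 : NonZeroVec y
  y≢0 with ¬∀⟶∃¬ n _ (λ j → finToFun x j ≟ᶠ finToFun x′ j)
             (<⇒≢ᶠ x<x′ ∘ finToFun-injective x x′)
  ... | j , xj≢x′j = j , xj≢x′j ∘ toℕ-injective ∘ m⊖n≡0⇒m≡n (point x j) (point x′ j)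

  y≤M : ∀ j → ∣ y j ∣ ≤ M
  y≤M j = ∣m⊖n∣≤ (point≤M x j) (point≤M x′ j)

-- Siegel's lemma with box size H = ∏ (1 + ∥C i∥₁), for which the count is H (1 + H)^m < (1 + H)^n.
kernel-vector : ∀ {m n} (C : ZMat m n) → m < n → ∃ λ y → orthLattice C y × NonZeroVec y
kernel-vector {m} {n} C m<n =
  let y , C⊥y , y≢0 , _ = siegel H C fewer-codes in y , C⊥y , y≢0
  where
  H = ∏ (λ i → suc ∥ C i ∥₁)

  factor≤ : ∀ a → suc (a * H) ≤ suc a * suc H
  factor≤ a = s≤s (≤-trans (*-monoʳ-≤ a (n≤1+n H)) (m≤n+m (a * suc H) H))

  fewer-codes : ∏ (λ i → suc (∥ C i ∥₁ * H)) < suc H ^ n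
  fewer-codes = begin-strict
    ∏ (λ i → suc (∥ C i ∥₁ * H))      ≤⟨ ∏-mono-≤ (λ i → factor≤ ∥ C i ∥₁) ⟩
    ∏ (λ i → suc ∥ C i ∥₁ * suc H)    ≡⟨ ∏-distrib-* (λ i → suc ∥ C i ∥₁) (λ _ → suc H) ⟩
    H * ∏ {m} (λ _ → suc H)           ≡⟨ cong (H *_) (∏-const m) ⟩
    H * suc H ^ m                     <⟨ *-monoˡ-< (suc H ^ m) {{m^n≢0 (suc H) m}} (n<1+n H) ⟩
    suc H ^ suc m                     ≤⟨ ^-monoʳ-≤ (suc H) m<n ⟩
    suc H ^ n                         ∎
    where open ≤-Reasoning

linIndep⇒≤ : ∀ {k n} (v : Fin k → ZVec n) → LinIndep v → k ≤ n
linIndep⇒≤ v indep = ≮⇒≥ λ n<k →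
  let c , c⊥columns , i , cᵢ≢0 = kernel-vector (λ j i → v i j) n<k
  in  cᵢ≢0 (indep c (λ j → trans (dot-comm c (λ i → v i j)) (c⊥columns j)) i)

orthLattice-rank : ∀ {k d n} (X : ZMat k n) → LinIndep X → k + d ≡ n →
                   (Y : Fin d → ZVec n) → AllIn (orthLattice X) Y → LinIndep Y →
                   LatticeRank (orthLattice X) d
orthLattice-rank {k} {d} {n} X indX k+d≡n Y Y∈L indY = (Y , Y∈L , indY) , too-many
  where
  too-many : (z : Fin (suc d) → ZVec n) → AllIn (orthLattice X) z → ¬ LinIndep z
  too-many z z∈L indz = n≮n n (subst (_≤ n) (trans (+-suc k d) (cong suc k+d≡n))
                                 (linIndep⇒≤ (X ++ z) (linIndep-++ X z indX indz z∈L)))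

sqNorm-≤ : ∀ {n M} (v : ZVec n) → (∀ j → ∣ v j ∣ ≤ M) → sqNorm v Z.≤ + (n * (M * M))
sqNorm-≤ v v≤M =
  subst (Z._≤ _) (sym (sqNorm≡∑ℕ v)) (Z.+≤+ (∑ℕ-≤-* (λ j → *-mono-≤ (v≤M j) (v≤M j))))

short-echelon-in-orthLattice :
  ∀ {r n M d} (A : ZMat r n) → (∀ i j → ∣ A i j ∣ ≤ M) → n ≤ M → 3 * r + d ≤ n →
  ∃₂ λ (Y : Fin d → ZVec n) piv →
    AllIn (λ y → orthLattice A y × (∀ j → ∣ y j ∣ ≤ M)) Y × Echelon Y piv
short-echelon-in-orthLattice {r} {n} {M} {d} A A≤M n≤M 3r+d≤n = echelon-build _ d extend
  where
  extend : ∀ {s} → s < d → (piv : Fin s → Fin n) →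
           ∃ λ y → (orthLattice A y × (∀ j → ∣ y j ∣ ≤ M)) × (∀ k → y (piv k) ≡ 0ℤ) × NonZeroVec y
  extend {s} s<d piv =
    let y , y⊥C , y≢0 , y≤M = siegel M C fewer-codes
    in  y , (orthLattice-++⁻ˡ A _ y⊥C , y≤M) ,
        orthLattice-unitVecs piv (orthLattice-++⁻ʳ A _ y⊥C) , y≢0
    where
    C = A ++ unitVec ∘ piv

    3r+s<n : 3 * r + s < n
    3r+s<n = <-≤-trans (+-monoʳ-< (3 * r) s<d) 3r+d≤n

    1<1+M : 1 < suc M
    1<1+M = s≤s (≤-trans (≤-trans (s≤s z≤n) 3r+s<n) n≤M)

    A-factor≤ : ∀ i → suc (∥ C (i ↑ˡ s) ∥₁ * M) ≤ suc M ^ 3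
    A-factor≤ i = begin
      suc (∥ C (i ↑ˡ s) ∥₁ * M)  ≡⟨ cong (λ a → suc (∥ a ∥₁ * M)) (lookup-++ˡ A _ i) ⟩
      suc (∥ A i ∥₁ * M)         ≤⟨ s≤s (*-monoˡ-≤ M (∑ℕ-≤-* (A≤M i))) ⟩
      suc (n * M * M)            ≤⟨ s≤s (*-monoˡ-≤ M (*-monoˡ-≤ M n≤M)) ⟩
      suc (M * M * M)            ≡⟨ cong suc (*-assoc M M M) ⟩
      suc (M * (M * M))          ≡⟨ cong (λ x → suc (M * (M * x))) (*-identityʳ M) ⟨
      suc (M ^ 3)                ≤⟨ ^-monoˡ-< 3 (n<1+n M) ⟩
      suc M ^ 3                  ∎
      where open ≤-Reasoning

    unit-factor≤ : ∀ k → suc (∥ C (r ↑ʳ k) ∥₁ * M) ≤ suc M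
    unit-factor≤ k = ≤-reflexive (cong suc (begin
      ∥ C (r ↑ʳ k) ∥₁ * M          ≡⟨ cong (λ a → ∥ a ∥₁ * M) (lookup-++ʳ A _ k) ⟩
      ∥ unitVec (piv k) ∥₁ * M     ≡⟨ cong (_* M) (∥unitVec∥₁ (piv k)) ⟩
      1 * M                        ≡⟨ *-identityˡ M ⟩
      M                            ∎))
      where open ≡-Reasoning

    fewer-codes : ∏ (λ i → suc (∥ C i ∥₁ * M)) < suc M ^ n
    fewer-codes = begin-strict
      ∏ (λ i → suc (∥ C i ∥₁ * M))
        ≡⟨ ∏-splitAt r (λ i → suc (∥ C i ∥₁ * M)) ⟩
      ∏ (λ i → suc (∥ C (i ↑ˡ s) ∥₁ * M)) * ∏ (λ k → suc (∥ C (r ↑ʳ k) ∥₁ * M))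
        ≤⟨ *-mono-≤ (∏-≤-^ A-factor≤) (∏-≤-^ unit-factor≤) ⟩
      (suc M ^ 3) ^ r * suc M ^ s
        ≡⟨ cong (_* suc M ^ s) (^-*-assoc (suc M) 3 r) ⟩
      suc M ^ (3 * r) * suc M ^ s
        ≡⟨ ^-distribˡ-+-* (suc M) (3 * r) s ⟨
      suc M ^ (3 * r + s)
        <⟨ ^-monoʳ-< (suc M) 1<1+M 3r+s<n ⟩
      suc M ^ n
        ∎
      where open ≤-Reasoning

echelon-in-orthLattice : ∀ {m n t} (X : ZMat m n) → m + t ≤ n →
                         ∃₂ λ (B : Fin t → ZVec n) piv → AllIn (orthLattice X) B × Echelon B piv
echelon-in-orthLattice {m} {n} {t} X m+t≤n = echelon-build (orthLattice X) t extend
  where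
  extend : ∀ {s} → s < t → (piv : Fin s → Fin n) →
           ∃ λ y → orthLattice X y × (∀ k → y (piv k) ≡ 0ℤ) × NonZeroVec y
  extend s<t piv =
    let y , y⊥C , y≢0 = kernel-vector (X ++ unitVec ∘ piv) (<-≤-trans (+-monoʳ-< m s<t) m+t≤n)
    in  y , orthLattice-++⁻ˡ X _ y⊥C , orthLattice-unitVecs piv (orthLattice-++⁻ʳ X _ y⊥C) , y≢0

lemma3p1 : (r n M : ℕ) (A : ZMat r n) →
    4 * r ≤ n →
    LinIndep A →
    (∀ i j → ∣ A i j ∣ ≤ M) →
    n ≤ M →
    ∃ λ t → (r + t ≤ 4 * r) × Σ (ZMat t n) (λ B →
    LambdaMaxSq≤ (orthLattice (A ++ B)) (+ (n * (M * M))))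
lemma3p1 r n M A 4r≤n indA A≤M n≤M =
  let Y , _ , Y∈ , echY  = short-echelon-in-orthLattice A A≤M n≤M 3r+d≤n
      B , _ , B∈ , echB  = echelon-in-orthLattice (A ++ Y) r+d+3r≤n
      indY  = echelon⇒linIndep echY
      indAB = linIndep-++ A B indA (echelon⇒linIndep echB) (orthLattice-++⁻ˡ A Y ∘ B∈)
      Y⊥B   = orthLattice-sym Y B (orthLattice-++⁻ʳ A Y ∘ B∈)
      Y∈L   = λ k → orthLattice-++ A B (proj₁ (Y∈ k)) (Y⊥B k)
  in  3 * r , ≤-refl , B ,
      d , orthLattice-rank (A ++ B) indAB 4r+d≡n Y Y∈L indY ,
      Y , Y∈L , indY , λ i → sqNorm-≤ (Y i) (proj₂ (Y∈ i))
  where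
  d = n ∸ 4 * r

  4r+d≡n : 4 * r + d ≡ n
  4r+d≡n = m+[n∸m]≡n 4r≤n

  3r+d≤n : 3 * r + d ≤ n
  3r+d≤n = ≤-trans (m≤n+m (3 * r + d) r) (≤-reflexive (trans (sym (+-assoc r (3 * r) d)) 4r+d≡n))

  r+d+3r≤n : r + d + 3 * r ≤ n
  r+d+3r≤n = ≤-reflexive (trans (regroup r d) 4r+d≡n)
    where
    regroup : ∀ r d → r + d + 3 * r ≡ 4 * r + d
    regroup = solve-∀
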